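{- Let $G$ be a graph of order $n\geq 2$ and $\overline{G}$ its complement. If $k=2$, then $3\leq \gamma^r_2(G)+\gamma^r_2(\overline{G})\leq 2n-1$ and $2\leq \gamma^r_2(G)\cdot\gamma^r_2(\overline{G})\leq n(n-1)$; the lower bounds are attained if and only if $G\in\{K_2,\overline{K}_2,P_3,\overline{P}_3\}$, and the upper bounds are attained if and only if $G\in\{K_n,\overline{K}_n\}$. If $k\geq 3$, then $2\leq \gamma^r_k(G)+\gamma^r_k(\overline{G})\leq 2n-1$ and $1\leq \gamma^r_k(G)\cdot\gamma^r_k(\overline{G})\leq n(n-1)$; the lower bounds are attained if and only if $G\cong P_4$, and the upper bounds are attained if and only if $G\in\{K_n,\overline{K}_n\}$.
   Context: $P_m$ is the path on $m$ vertices, $K_m$ the complete graph, $\overline{K}_m$ the edgeless graph. For a graph $G=(V,E)$ (not necessarily connected; distances between vertices in different components are $\infty$) and $k\geq 1$, a set $D\subseteq V$ is distance $k$-dominating if every $v\in V\setminus D$ is at distance at most $k$ from some vertex of $D$. An ordered set $W=\{w_1,\dots,w_r\}$ is a resolving set if for all distinct $u,v\in V\setminus W$ the distance vectors $(d_G(u,w_i))_i$ and $(d_G(v,w_i))_i$ differ. $\gamma^r_k(G)$ is the minimum cardinality of a set that is both resolving and distance $k$-dominating. -}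

module Defs where

open import Data.Bool using (Bool; true; false; not; _∨_; if_then_else_)
open import Data.Bool.Properties using (∨-comm)
open import Data.Nat using (ℕ; zero; suc; _≤_; _<_; _≡ᵇ_)
open import Data.Fin using (Fin; toℕ; _≟_)
open import Data.Fin.Subset using (Subset; _∈_; _∉_; ∣_∣)
open import Data.Product using (Σ; ∃; _×_; _,_)
open import Function.Bundles using (_↔_; Inverse; _⇔_)
open import Data.Empty using (⊥-elim)
open import Relation.Nullary using (¬_; yes; no)
open import Relation.Binary.PropositionalEquality using (_≡_; refl; sym; trans; cong)

record Graph (n : ℕ) : Set where
  field
    adj    : Fin n → Fin n → Bool
    adj-sym    : ∀ u v → adj u v ≡ adj v u
    adj-irrefl : ∀ u → adj u u ≡ false
open Graph public

complement : ∀ {n} → Graph n → Graph n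
complement {n} G = record { adj = a ; adj-sym = s ; adj-irrefl = i }
  where
  a : Fin n → Fin n → Bool
  a u v with u ≟ v
  ... | yes _ = false
  ... | no _  = not (adj G u v)
  s : ∀ u v → a u v ≡ a v u
  s u v with u ≟ v | v ≟ u
  ... | yes _ | yes _ = refl
  ... | yes p | no q = ⊥-elim (q (sym p))
  ... | no p | yes q = ⊥-elim (p (sym q))
  ... | no _ | no _ = cong not (adj-sym G u v)
  i : ∀ u → a u u ≡ false
  i u with u ≟ u
  ... | yes _ = refl
  ... | no p = ⊥-elim (p refl)

K : (m : ℕ) → Graph m
K m = record { adj = a ; adj-sym = s ; adj-irrefl = i }
  where
  a : Fin m → Fin m → Bool
  a u v with u ≟ v
  ... | yes _ = false
  ... | no _  = true
  s : ∀ u v → a u v ≡ a v u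
  s u v with u ≟ v | v ≟ u
  ... | yes _ | yes _ = refl
  ... | yes p | no q = ⊥-elim (q (sym p))
  ... | no p | yes q = ⊥-elim (p (sym q))
  ... | no _ | no _ = refl
  i : ∀ u → a u u ≡ false
  i u with u ≟ u
  ... | yes _ = refl
  ... | no p = ⊥-elim (p refl)

Kbar : (m : ℕ) → Graph m
Kbar m = record { adj = λ _ _ → false ; adj-sym = λ _ _ → refl ; adj-irrefl = λ _ → refl }

private
  suc≢ᵇ : ∀ x → (suc x ≡ᵇ x) ≡ false
  suc≢ᵇ zero = refl
  suc≢ᵇ (suc x) = suc≢ᵇ x

P : (m : ℕ) → Graph m
P m = record
  { adj = λ u v → (suc (toℕ u) ≡ᵇ toℕ v) ∨ (suc (toℕ v) ≡ᵇ toℕ u)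
  ; adj-sym = λ u v → ∨-comm (suc (toℕ u) ≡ᵇ toℕ v) (suc (toℕ v) ≡ᵇ toℕ u)
  ; adj-irrefl = λ u → irr u
  }
  where
  irr : ∀ u → ((suc (toℕ u) ≡ᵇ toℕ u) ∨ (suc (toℕ u) ≡ᵇ toℕ u)) ≡ false
  irr u rewrite suc≢ᵇ (toℕ u) = refl

_≅_ : ∀ {n m} → Graph n → Graph m → Set
_≅_ {n} {m} G H = Σ (Fin n ↔ Fin m) λ f →
  ∀ u v → adj G u v ≡ adj H (Inverse.to f u) (Inverse.to f v)

data Walk {n} (G : Graph n) : Fin n → Fin n → ℕ → Set where
  here : ∀ {u} → Walk G u u 0
  step : ∀ {u v w m} → adj G u v ≡ true → Walk G v w m → Walk G u w (suc m)

-- d_G(u,w) = m  (if no walk exists, d_G(u,w) = ∞ and IsDist holds for no m).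
IsDist : ∀ {n} → Graph n → Fin n → Fin n → ℕ → Set
IsDist G u w m = Walk G u w m × (∀ j → j < m → ¬ Walk G u w j)

-- d_G(u,w) = d_G(v,w) (as elements of ℕ ∪ {∞}).
SameDist : ∀ {n} → Graph n → Fin n → Fin n → Fin n → Set
SameDist G u v w = ∀ m → IsDist G u w m ⇔ IsDist G v w m

Resolving : ∀ {n} → Graph n → Subset n → Set
Resolving G W = ∀ u v → u ∉ W → v ∉ W → (∀ w → w ∈ W → SameDist G u v w) → u ≡ v

KDominating : ∀ {n} → Graph n → ℕ → Subset n → Set
KDominating G k D = ∀ v → v ∉ D → ∃ λ w → w ∈ D × ∃ λ j → j ≤ k × Walk G w v j

IsGammaR : ∀ {n} → Graph n → ℕ → ℕ → Set
IsGammaR G k g =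
  (∃ λ S → Resolving G S × KDominating G k S × ∣ S ∣ ≡ g)
  × (∀ S → Resolving G S → KDominating G k S → g ≤ ∣ S ∣)

{-# OPTIONS --safe #-}
-- γ^r_k(G) = 1 exactly when G is a path P_n with n ≤ k + 1: if {w} is resolving and dominating,
-- v ↦ d(v, w) is a finite injective distance function, which forces G to be a path ending at w.  Since G and its complement are both paths only for G ≅ P₄, the two invariants
-- can both equal 1 only when k ≥ 3 and G ≅ P₄; for k = 2 the extremal graphs are those in which
-- one of G, Ḡ is a path on at most three vertices.  For the upper bounds, V ∖ {u} is a resolving
-- k-dominating set whenever u has a neighbour, so γ^r_k(G) ≤ n − 1 unless G is edgeless, in which
-- case γ^r_k(G) = n and Ḡ = K_n has γ^r_k = n − 1.
module Submission where

open import Defs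
open import Data.Bool using (true; false; not; T; _∨_) renaming (_≟_ to _≟ᵇ_)
open import Data.Bool.Properties using (not-injective; not-involutive; ¬-not; T-≡; T-∨; ⇔→≡)
open import Data.Empty using (⊥; ⊥-elim)
open import Data.Fin using (Fin; toℕ; fromℕ<; _≟_) renaming (zero to fz; suc to fs)
open import Data.Fin.Properties using (toℕ-injective; toℕ-fromℕ<; toℕ<n; any?; injective⇒≤; cantor-schröder-bernstein)
open import Data.Fin.Subset using (Subset; _∈_; _∉_; ∣_∣; ⁅_⁆; ⊤; ∁; inside; outside)
open import Data.Fin.Subset.Properties
  using (x∈⁅y⁆⇒x≡y; x∈⁅x⁆; ∣⁅x⁆∣≡1; ∣⊤∣≡n; ∈⊤; _∈?_; x∉∁p⇒x∈p; x∉p⇒x∈∁p; x∈∁p⇒x∉p; p⊆q⇒∣p∣≤∣q∣; ∣∁p∣≡n∸∣p∣; ∣p∣≤n; Empty-unique)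
open import Data.Nat using (ℕ; zero; suc; _+_; _*_; _∸_; _≤_; _<_; z≤n; s≤s; _≡ᵇ_; _<ᵇ_; _≤?_)
open import Data.Nat.Properties
  using (≡ᵇ⇒≡; ≡⇒≡ᵇ; <ᵇ⇒<; suc-injective; 0≢1+n; ≤-refl; ≤-reflexive; ≤-antisym; ≤-trans; ≤-pred; ≤-<-trans;
         <⇒≤; <⇒≢; <⇒≱; ≤⇒≯; ≮⇒≥; ≰⇒>; ≤∧≢⇒<; 1+n≰n; n≤1+n; n<1+n; m≤n⇒m≤1+n; m≤n⇒m<n∨m≡n; n≤0⇒n≡0;
         m≤m+n; m∸n≤m; +-comm; +-suc; +-identityʳ; +-mono-≤; +-monoˡ-≤; +-monoʳ-≤; +-mono-<-≤;
         *-comm; *-mono-≤; *-monoˡ-≤; *-monoˡ-<; *-cancelˡ-≤; m*n≡1⇒m≡1; m*n≡1⇒n≡1)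
open import Data.Product using (Σ; ∃; ∃₂; _×_; _,_; proj₁; proj₂)
open import Data.Sum using (_⊎_; inj₁; inj₂; [_,_])
open import Data.Vec using (_∷_)
open import Function using (_∘_)
open import Function.Bundles using (_⇔_; Inverse; mk↔ₛ′; mk⇔; Equivalence)
open import Function.Construct.Composition using (_↔-∘_; _⇔-∘_)
open import Function.Construct.Identity using (↔-id)
open import Function.Construct.Symmetry using (⇔-sym)
open import Relation.Nullary using (¬_; Dec; yes; no; contradiction)
open import Relation.Nullary.Decidable using (map′)
open import Relation.Unary using (Decidable)
open import Relation.Binary.PropositionalEquality using (_≡_; _≢_; refl; sym; trans; cong; subst; subst₂)

open Equivalence using (to; from)

Edgeless : ∀ {n} → Graph n → Set
Edgeless G = ∀ u v → adj G u v ≡ false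

Complete : ∀ {n} → Graph n → Set
Complete G = ∀ u v → u ≢ v → adj G u v ≡ true

HasEdge : ∀ {n} → Graph n → Set
HasEdge G = ∃₂ λ u v → adj G u v ≡ true

edge⇒≢ : ∀ {n} (G : Graph n) {u v} → adj G u v ≡ true → u ≢ v
edge⇒≢ G {u} e refl with trans (sym e) (adj-irrefl G u)
... | ()

complement-adj : ∀ {n} (G : Graph n) {u v} → u ≢ v → adj (complement G) u v ≡ not (adj G u v)
complement-adj G {u} {v} u≢v with u ≟ v
... | yes u≡v = contradiction u≡v u≢v
... | no _    = refl

complement-edge⇒non-edge : ∀ {n} (G : Graph n) {u v} → adj (complement G) u v ≡ true → adj G u v ≡ false
complement-edge⇒non-edge G e = not-injective (trans (sym (complement-adj G (edge⇒≢ (complement G) e))) e)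

non-edge⇒complement-edge : ∀ {n} (G : Graph n) {u v} → u ≢ v → adj G u v ≡ false → adj (complement G) u v ≡ true
non-edge⇒complement-edge G u≢v e = trans (complement-adj G u≢v) (cong not e)

complement-involutive : ∀ {n} (G : Graph n) u v → adj (complement (complement G)) u v ≡ adj G u v
complement-involutive G u v with u ≟ v
... | yes refl = sym (adj-irrefl G u)
... | no u≢v   = trans (cong not (complement-adj G u≢v)) (not-involutive (adj G u v))

K-complete : ∀ m → Complete (K m)
K-complete m u v u≢v with u ≟ v
... | yes u≡v = contradiction u≡v u≢v
... | no _    = refl

complete⇒complement-edgeless : ∀ {n} {G : Graph n} → Complete G → Edgeless (complement G)
complete⇒complement-edgeless c u v with u ≟ v
... | yes _  = refl
... | no u≢v = cong not (c u v u≢v)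

edgeless⇒complement-complete : ∀ {n} {G : Graph n} → Edgeless G → Complete (complement G)
edgeless⇒complement-complete {G = G} e u v u≢v = non-edge⇒complement-edge G u≢v (e u v)

data Consecutive : ℕ → ℕ → Set where
  up   : ∀ {x} → Consecutive x (suc x)
  down : ∀ {x} → Consecutive (suc x) x

Near : ℕ → ℕ → Set
Near x y = x ≡ y ⊎ Consecutive x y

consecutive-suc : ∀ {x y} → Consecutive x y → Consecutive (suc x) (suc y)
consecutive-suc up   = up
consecutive-suc down = down

consecutive-cases : ∀ {x y} → Consecutive x y → y ≡ suc x ⊎ x ≡ suc y
consecutive-cases up   = inj₁ refl
consecutive-cases down = inj₂ refl

≤-suc-both⇒consecutive : ∀ {x y} → x ≤ suc y → y ≤ suc x → x ≢ y → Consecutive x y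
≤-suc-both⇒consecutive {zero}        {zero}        _       _       x≢y = contradiction refl x≢y
≤-suc-both⇒consecutive {zero}        {suc zero}    _       _       _   = up
≤-suc-both⇒consecutive {zero}        {suc (suc _)} _       (s≤s ()) _
≤-suc-both⇒consecutive {suc zero}    {zero}        _       _       _   = down
≤-suc-both⇒consecutive {suc (suc _)} {zero}        (s≤s ()) _      _
≤-suc-both⇒consecutive {suc x}       {suc y}       (s≤s p) (s≤s q) x≢y =
  consecutive-suc (≤-suc-both⇒consecutive p q (x≢y ∘ cong suc))

consecutiveᵇ : ∀ x y → T ((suc x ≡ᵇ y) ∨ (suc y ≡ᵇ x)) ⇔ Consecutive x y
consecutiveᵇ x y = mk⇔ ⇒ ⇐
  where
  ⇒ : T ((suc x ≡ᵇ y) ∨ (suc y ≡ᵇ x)) → Consecutive x y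
  ⇒ t with to T-∨ t
  ... | inj₁ t′ = subst (Consecutive x) (≡ᵇ⇒≡ (suc x) y t′) up
  ... | inj₂ t′ = subst (λ z → Consecutive z y) (≡ᵇ⇒≡ (suc y) x t′) down
  ⇐ : ∀ {x y} → Consecutive x y → T ((suc x ≡ᵇ y) ∨ (suc y ≡ᵇ x))
  ⇐ {x} up       = from T-∨ (inj₁ (≡⇒≡ᵇ (suc x) (suc x) refl))
  ⇐ {_} {y} down = from T-∨ (inj₂ (≡⇒≡ᵇ (suc y) (suc y) refl))

P-adj : ∀ {m} (u v : Fin m) → adj (P m) u v ≡ true ⇔ Consecutive (toℕ u) (toℕ v)
P-adj u v = consecutiveᵇ (toℕ u) (toℕ v) ⇔-∘ ⇔-sym T-≡

least : ∀ {P : ℕ → Set} → Decidable P → ∀ {j} → P j → ∃ λ m → P m × (∀ i → i < m → ¬ P i)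
least P? {zero} p = 0 , p , λ _ ()
least P? {suc j} p with P? 0
... | yes p₀ = 0 , p₀ , λ _ ()
... | no ¬p₀ with least (P? ∘ suc) p
...   | m , pm , below = suc m , pm , λ where
          zero    _         → ¬p₀
          (suc i) (s≤s i<m) → below i i<m

module _ {n} {G : Graph n} where

  walk-length-0 : ∀ {u v} → Walk G u v 0 → u ≡ v
  walk-length-0 here = refl

  walk-snoc : ∀ {u v x j} → Walk G u v j → adj G v x ≡ true → Walk G u x (suc j)
  walk-snoc here        e = step e here
  walk-snoc (step e′ w) e = step e′ (walk-snoc w e)

  walk-reverse : ∀ {u v j} → Walk G u v j → Walk G v u j
  walk-reverse here               = here
  walk-reverse (step {u} {v} e w) = walk-snoc (walk-reverse w) (trans (adj-sym G v u) e)

  edge⇒IsDist1 : ∀ {u v} → adj G u v ≡ true → IsDist G u v 1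
  edge⇒IsDist1 e = step e here , λ where
    zero    _         w → edge⇒≢ G e (walk-length-0 w)
    (suc _) (s≤s ()) _

  IsDist-minimal : ∀ {u v m j} → IsDist G u v m → Walk G u v j → m ≤ j
  IsDist-minimal (_ , shortest) w = ≮⇒≥ λ j<m → shortest _ j<m w

  IsDist-unique : ∀ {u v m m′} → IsDist G u v m → IsDist G u v m′ → m ≡ m′
  IsDist-unique d d′ = ≤-antisym (IsDist-minimal d (proj₁ d′)) (IsDist-minimal d′ (proj₁ d))

  same-distance : ∀ {u v w m} → IsDist G u w m → IsDist G v w m → SameDist G u v w
  same-distance du dv m′ =
    mk⇔ (λ d → subst (IsDist G _ _) (IsDist-unique du d) dv)
        (λ d → subst (IsDist G _ _) (IsDist-unique dv d) du)

walk? : ∀ {n} (G : Graph n) j u v → Dec (Walk G u v j)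
walk? G zero    u v = map′ (λ { refl → here }) walk-length-0 (u ≟ v)
walk? G (suc j) u v =
  map′ (λ (x , e , w) → step e w) (λ { (step e w) → _ , e , w }) (any? first-step?)
  where
  first-step? : ∀ x → Dec (adj G u x ≡ true × Walk G x v j)
  first-step? x with adj G u x ≟ᵇ true | walk? G j x v
  ... | yes e | yes w = yes (e , w)
  ... | no ¬e | _     = no (¬e ∘ proj₁)
  ... | yes _ | no ¬w = no (¬w ∘ proj₂)

distance : ∀ {n} {G : Graph n} {u v j} → Walk G u v j → ∃ (IsDist G u v)
distance {G = G} {u} {v} = least (λ j → walk? G j u v)

-- G is a path whose vertices carry the labels 0, 1, 2, … from one end;
-- the label of a vertex is its distance to that end.
record PathLabelling {n} (G : Graph n) : Set where
  field
    label            : Fin n → ℕ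
    label-injective  : ∀ u v → label u ≡ label v → u ≡ v
    edge⇒consecutive : ∀ u v → adj G u v ≡ true → Consecutive (label u) (label v)
    descend          : ∀ v m → label v ≡ suc m → ∃ λ u → adj G v u ≡ true × label u ≡ m

module PathLabellingProperties {n} {G : Graph n} (L : PathLabelling G) where
  open PathLabelling L

  successor⇒edge : ∀ u v → label u ≡ suc (label v) → adj G u v ≡ true
  successor⇒edge u v e with descend u (label v) e
  ... | x , u~x , lx≡lv with label-injective x v lx≡lv
  ...   | refl = u~x

  edge⇔consecutive : ∀ {u v} → adj G u v ≡ true ⇔ Consecutive (label u) (label v)
  edge⇔consecutive {u} {v} = mk⇔ (edge⇒consecutive u v) λ c → case (consecutive-cases c)
    where
    case : label v ≡ suc (label u) ⊎ label u ≡ suc (label v) → adj G u v ≡ true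
    case (inj₁ e) = trans (adj-sym G u v) (successor⇒edge v u e)
    case (inj₂ e) = successor⇒edge u v e

  labels-below : ∀ d v → label v ≡ d → ∀ i → i ≤ d → ∃ λ u → label u ≡ i
  labels-below d v e i i≤d with m≤n⇒m<n∨m≡n i≤d
  ... | inj₂ refl = v , e
  labels-below (suc d) v e i _ | inj₁ (s≤s i≤d) with descend v d e
  ... | u , _ , lu≡d = labels-below d u lu≡d i i≤d

  -- Otherwise the labels 0, …, n would all occur below label v, on n + 1 distinct vertices.
  label<n : ∀ v → label v < n
  label<n v = ≰⇒> λ n≤lv → 1+n≰n (injective⇒≤ (injective n≤lv))
    where
    vertex : n ≤ label v → Fin (suc n) → Fin n
    vertex n≤lv i = proj₁ (labels-below (label v) v refl (toℕ i) (≤-trans (≤-pred (toℕ<n i)) n≤lv))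
    injective : ∀ n≤lv {i j} → vertex n≤lv i ≡ vertex n≤lv j → i ≡ j
    injective n≤lv {i} {j} e = toℕ-injective (trans (sym (proj₂ (labels-below _ v refl (toℕ i) _)))
                                              (trans (cong label e) (proj₂ (labels-below _ v refl (toℕ j) _))))

  label-surjective : ∀ {i} → i < n → ∃ λ u → label u ≡ i
  label-surjective {i} i<n with any? (λ v → i ≤? label v)
  ... | yes (v , i≤lv) = labels-below (label v) v refl i i≤lv
  ... | no none = contradiction i<n (≤⇒≯ (injective⇒≤ {f = λ v → fromℕ< (labels-lt v)} injective))
    where
    labels-lt : ∀ v → label v < i
    labels-lt v = ≰⇒> λ i≤lv → none (v , i≤lv)
    injective : ∀ {u v} → fromℕ< (labels-lt u) ≡ fromℕ< (labels-lt v) → u ≡ v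
    injective {u} {v} e = label-injective u v
      (trans (sym (toℕ-fromℕ< (labels-lt u))) (trans (cong toℕ e) (toℕ-fromℕ< (labels-lt v))))

  order-≤ : ∀ {k} → (∀ v → label v ≤ k) → n ≤ suc k
  order-≤ {k} bound = ≮⇒≥ λ 1+k<n → let v , lv = label-surjective 1+k<n in 1+n≰n (subst (_≤ k) lv (bound v))

  walk-to-root : ∀ {r} → label r ≡ 0 → ∀ d v → label v ≡ d → Walk G v r d
  walk-to-root lr zero v lv rewrite label-injective v _ (trans lv (sym lr)) = here
  walk-to-root lr (suc d) v lv with descend v d lv
  ... | u , v~u , lu = step v~u (walk-to-root lr d u lu)

  label-≤-walk : ∀ {u x j} → Walk G u x j → label u ≤ j + label x
  label-≤-walk here = ≤-refl
  label-≤-walk {u} {x} (step {v = y} {m = j} u~y w) with consecutive-cases (edge⇒consecutive u y u~y)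
  ... | inj₁ ly≡1+lu = m≤n⇒m≤1+n (≤-trans (n≤1+n (label u)) (subst (_≤ j + label x) ly≡1+lu (label-≤-walk w)))
  ... | inj₂ lu≡1+ly = subst (_≤ suc (j + label x)) (sym lu≡1+ly) (s≤s (label-≤-walk w))

  module Root {r} (r-root : label r ≡ 0) where

    IsDist-root : ∀ v → IsDist G v r (label v)
    IsDist-root v = walk-to-root r-root (label v) v refl , λ j j<lv w →
      <⇒≱ j<lv (subst (label v ≤_) (trans (cong (j +_) r-root) (+-identityʳ j)) (label-≤-walk w))

    root-resolving : Resolving G ⁅ r ⁆
    root-resolving u v _ _ same = label-injective u v
      (IsDist-unique (to (same r (x∈⁅x⁆ r) (label u)) (IsDist-root u)) (IsDist-root v))

    root-dominating : ∀ {k} → (∀ v → label v ≤ k) → KDominating G k ⁅ r ⁆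
    root-dominating bound v _ = r , x∈⁅x⁆ r , label v , bound v , walk-reverse (proj₁ (IsDist-root v))

    root-neighbour-unique : ∀ {u v} → adj G r u ≡ true → adj G r v ≡ true → u ≡ v
    root-neighbour-unique r~u r~v = label-injective _ _ (trans (label-one r~u) (sym (label-one r~v)))
      where
      label-one : ∀ {x} → adj G r x ≡ true → label x ≡ 1
      label-one {x} r~x with consecutive-cases (edge⇒consecutive r x r~x)
      ... | inj₁ lx≡1+lr = trans lx≡1+lr (cong suc r-root)
      ... | inj₂ lr≡1+lx = contradiction (trans (sym r-root) lr≡1+lx) 0≢1+n

  has-neighbour : 2 ≤ n → ∀ v → ∃ λ u → adj G v u ≡ true
  has-neighbour 2≤n v with label v in lv
  ... | suc m = let u , v~u , _ = descend v m lv in u , v~u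
  ... | zero  = let u , lu = label-surjective 2≤n in u , trans (adj-sym G v u) (successor⇒edge u v (trans lu (cong suc (sym lv))))

  complement-edge⇔not-near : ∀ {v x} → adj (complement G) v x ≡ true ⇔ (¬ Near (label v) (label x))
  complement-edge⇔not-near {v} {x} = mk⇔ ⇒ ⇐
    where
    ⇒ : adj (complement G) v x ≡ true → ¬ Near (label v) (label x)
    ⇒ e (inj₁ lv≡lx) = edge⇒≢ (complement G) e (label-injective v x lv≡lx)
    ⇒ e (inj₂ c) with trans (sym (complement-edge⇒non-edge G e)) (from edge⇔consecutive c)
    ... | ()
    ⇐ : ¬ Near (label v) (label x) → adj (complement G) v x ≡ true
    ⇐ far = non-edge⇒complement-edge G (λ { refl → far (inj₁ refl) }) (¬-not (far ∘ inj₂ ∘ edge⇒consecutive v x))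

  path-has-non-edge : 3 ≤ n → ∃₂ λ u v → u ≢ v × adj G u v ≡ false
  path-has-non-edge 3≤n with label-surjective {0} (≤-trans (s≤s z≤n) 3≤n) | label-surjective {2} 3≤n
  ... | u , lu | v , lv =
    u , v , (λ { refl → 0≢1+n (trans (sym lu) lv) }) ,
    ¬-not λ u~v → contradiction (subst₂ Consecutive lu lv (edge⇒consecutive u v u~v)) λ ()

module _ {n m} {G : Graph n} {H : Graph m} (f : G ≅ H) where
  private
    φ = Inverse.to (proj₁ f)
    ψ = Inverse.from (proj₁ f)

  ≅-injective : ∀ {u v} → φ u ≡ φ v → u ≡ v
  ≅-injective {u} {v} e = trans (sym (Inverse.strictlyInverseʳ (proj₁ f) u))
                                (trans (cong ψ e) (Inverse.strictlyInverseʳ (proj₁ f) v))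

  ≅-order : n ≡ m
  ≅-order = cantor-schröder-bernstein ≅-injective λ {x} {y} e →
    trans (sym (Inverse.strictlyInverseˡ (proj₁ f) x)) (trans (cong φ e) (Inverse.strictlyInverseˡ (proj₁ f) y))

  ≅-complement : complement G ≅ complement H
  ≅-complement = proj₁ f , adj-preserved
    where
    adj-preserved : ∀ u v → adj (complement G) u v ≡ adj (complement H) (φ u) (φ v)
    adj-preserved u v with u ≟ v
    ... | yes refl = sym (adj-irrefl (complement H) (φ u))
    ... | no u≢v   = trans (cong not (proj₂ f u v)) (sym (complement-adj H (u≢v ∘ ≅-injective)))

  ≅-trans : ∀ {p} {I : Graph p} → H ≅ I → G ≅ I
  ≅-trans g = proj₁ g ↔-∘ proj₁ f , λ u v → trans (proj₂ f u v) (proj₂ g (φ u) (φ v))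

  ≅-complete : Complete H → Complete G
  ≅-complete c u v u≢v = trans (proj₂ f u v) (c (φ u) (φ v) (u≢v ∘ ≅-injective))

  ≅-edgeless : Edgeless H → Edgeless G
  ≅-edgeless e u v = trans (proj₂ f u v) (e (φ u) (φ v))

same-adj⇒≅ : ∀ {n} {G H : Graph n} → (∀ u v → adj G u v ≡ adj H u v) → G ≅ H
same-adj⇒≅ same = ↔-id _ , same

complement-≅ : ∀ {n m} {G : Graph n} {H : Graph m} → complement G ≅ H → G ≅ complement H
complement-≅ {G = G} {H} f =
  ≅-trans {G = G} {H = complement (complement G)} (same-adj⇒≅ {G = G} {H = complement (complement G)} (λ u v → sym (complement-involutive G u v)))
          {I = complement H} (≅-complement {G = complement G} {H = H} f)

edgeless⇒≅Kbar : ∀ {n} {G : Graph n} → Edgeless G → G ≅ Kbar n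
edgeless⇒≅Kbar {n} {G} e = same-adj⇒≅ {G = G} {H = Kbar n} e

complete⇒≅K : ∀ {n} {G : Graph n} → Complete G → G ≅ K n
complete⇒≅K {n} {G} c = same-adj⇒≅ {G = G} {H = K n} same
  where
  same : ∀ u v → adj G u v ≡ adj (K _) u v
  same u v with u ≟ v
  ... | yes refl = adj-irrefl G u
  ... | no u≢v   = c u v u≢v

≅P-resize : ∀ {n m} {G : Graph n} → G ≅ P m → G ≅ P n
≅P-resize {m = m} {G} f = subst (λ m → G ≅ P m) (sym (≅-order {G = G} {H = P m} f)) f

labelling⇒≅P : ∀ {n} {G : Graph n} → PathLabelling G → G ≅ P n
labelling⇒≅P {n} {G} L = mk↔ₛ′ position vertex position-vertex vertex-position , adj-preserved
  where
  open PathLabelling L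
  open PathLabellingProperties L
  position : Fin n → Fin n
  position v = fromℕ< (label<n v)
  vertex : Fin n → Fin n
  vertex i = proj₁ (label-surjective (toℕ<n i))
  toℕ-position : ∀ v → toℕ (position v) ≡ label v
  toℕ-position v = toℕ-fromℕ< (label<n v)
  position-vertex : ∀ i → position (vertex i) ≡ i
  position-vertex i = toℕ-injective (trans (toℕ-position (vertex i)) (proj₂ (label-surjective (toℕ<n i))))
  vertex-position : ∀ v → vertex (position v) ≡ v
  vertex-position v = label-injective _ _ (trans (proj₂ (label-surjective (toℕ<n (position v)))) (toℕ-position v))
  adj-preserved : ∀ u v → adj G u v ≡ adj (P n) (position u) (position v)
  adj-preserved u v = ⇔→≡ (⇔-sym (P-adj (position u) (position v)) ⇔-∘ (relabel ⇔-∘ edge⇔consecutive))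
    where
    relabel : Consecutive (label u) (label v) ⇔ Consecutive (toℕ (position u)) (toℕ (position v))
    relabel = mk⇔ (subst₂ Consecutive (sym (toℕ-position u)) (sym (toℕ-position v)))
                  (subst₂ Consecutive (toℕ-position u) (toℕ-position v))

≅P⇒labelling : ∀ {n m} {G : Graph n} → G ≅ P m → Σ (PathLabelling G) λ L → ∀ v → PathLabelling.label L v < m
≅P⇒labelling {n} {m} {G} (φ , adj-preserved) = L , λ v → toℕ<n (Inverse.to φ v)
  where
  label : Fin n → ℕ
  label v = toℕ (Inverse.to φ v)
  label-injective : ∀ u v → label u ≡ label v → u ≡ v
  label-injective u v e = ≅-injective {G = G} {H = P m} (φ , adj-preserved) (toℕ-injective e)
  descend : ∀ v k → label v ≡ suc k → ∃ λ u → adj G v u ≡ true × label u ≡ k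
  descend v k lv≡1+k = u , trans (adj-preserved v u) (from (P-adj _ _) (subst₂ Consecutive (sym lv≡1+k) (sym lu≡k) down)) , lu≡k
    where
    k<m : k < m
    k<m = ≤-trans (n≤1+n (suc k)) (subst (_< m) lv≡1+k (toℕ<n (Inverse.to φ v)))
    u : Fin n
    u = Inverse.from φ (fromℕ< k<m)
    lu≡k : label u ≡ k
    lu≡k = trans (cong toℕ (Inverse.strictlyInverseˡ φ (fromℕ< k<m))) (toℕ-fromℕ< k<m)
  L : PathLabelling G
  L = record
    { label            = label
    ; label-injective  = label-injective
    ; edge⇒consecutive = λ u v e → to (P-adj _ _) (trans (sym (adj-preserved u v)) e)
    ; descend          = descend
    }

module SingletonBasis {n} {G : Graph n} {k : ℕ} {w : Fin n}
  (resolving : Resolving G ⁅ w ⁆) (dominating : KDominating G k ⁅ w ⁆) where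

  short-walk : ∀ v → ∃ λ j → j ≤ k × Walk G v w j
  short-walk v with v ≟ w
  ... | yes refl = 0 , z≤n , here
  ... | no v≢w with dominating v (v≢w ∘ x∈⁅y⁆⇒x≡y w)
  ...   | x , x∈⁅w⁆ , j , j≤k , x⇝v with x∈⁅y⁆⇒x≡y w x∈⁅w⁆
  ...     | refl = j , j≤k , walk-reverse x⇝v

  dist : Fin n → ℕ
  dist v = proj₁ (distance (proj₂ (proj₂ (short-walk v))))

  dist-spec : ∀ v → IsDist G v w (dist v)
  dist-spec v = proj₂ (distance (proj₂ (proj₂ (short-walk v))))

  dist≤k : ∀ v → dist v ≤ k
  dist≤k v = ≤-trans (IsDist-minimal (dist-spec v) (proj₂ (proj₂ (short-walk v)))) (proj₁ (proj₂ (short-walk v)))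

  dist-w : dist w ≡ 0
  dist-w = n≤0⇒n≡0 (IsDist-minimal (dist-spec w) here)

  dist≡0⇒≡w : ∀ v → dist v ≡ 0 → v ≡ w
  dist≡0⇒≡w v e = walk-length-0 (subst (Walk G v w) e (proj₁ (dist-spec v)))

  dist-injective : ∀ u v → dist u ≡ dist v → u ≡ v
  dist-injective u v e = cases (u ≟ w) (v ≟ w)
    where
    cases : Dec (u ≡ w) → Dec (v ≡ w) → u ≡ v
    cases (yes u≡w) _         = trans u≡w (sym (dist≡0⇒≡w v (trans (sym e) (trans (cong dist u≡w) dist-w))))
    cases (no _)    (yes v≡w) = trans (dist≡0⇒≡w u (trans e (trans (cong dist v≡w) dist-w))) (sym v≡w)
    cases (no u≢w)  (no v≢w)  = resolving u v (u≢w ∘ x∈⁅y⁆⇒x≡y w) (v≢w ∘ x∈⁅y⁆⇒x≡y w) λ x x∈⁅w⁆ →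
      subst (SameDist G u v) (sym (x∈⁅y⁆⇒x≡y w x∈⁅w⁆))
            (same-distance (dist-spec u) (subst (IsDist G v w) (sym e) (dist-spec v)))

  edge⇒consecutive : ∀ u v → adj G u v ≡ true → Consecutive (dist u) (dist v)
  edge⇒consecutive u v u~v = ≤-suc-both⇒consecutive
    (IsDist-minimal (dist-spec u) (step u~v (proj₁ (dist-spec v))))
    (IsDist-minimal (dist-spec v) (step (trans (adj-sym G v u) u~v) (proj₁ (dist-spec u))))
    (edge⇒≢ G u~v ∘ dist-injective u v)

  descend : ∀ v m → dist v ≡ suc m → ∃ λ u → adj G v u ≡ true × dist u ≡ m
  descend v m e with subst (Walk G v w) e (proj₁ (dist-spec v))
  ... | step {v = u} v~u u⇝w = u , v~u , ≤-antisym (IsDist-minimal (dist-spec u) u⇝w)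
          (≤-pred (subst (_≤ suc (dist u)) e (IsDist-minimal (dist-spec v) (step v~u (proj₁ (dist-spec u))))))

  labelling : PathLabelling G
  labelling = record
    { label            = dist
    ; label-injective  = dist-injective
    ; edge⇒consecutive = edge⇒consecutive
    ; descend          = descend
    }

∈⇒1≤∣∣ : ∀ {n x} {S : Subset n} → x ∈ S → 1 ≤ ∣ S ∣
∈⇒1≤∣∣ {x = x} {S} x∈S =
  subst (_≤ ∣ S ∣) (∣⁅x⁆∣≡1 x) (p⊆q⇒∣p∣≤∣q∣ λ y∈⁅x⁆ → subst (_∈ S) (sym (x∈⁅y⁆⇒x≡y x y∈⁅x⁆)) x∈S)

∣p∣≡1⇒p≡⁅x⁆ : ∀ {n} (S : Subset n) → ∣ S ∣ ≡ 1 → ∃ λ w → S ≡ ⁅ w ⁆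
∣p∣≡1⇒p≡⁅x⁆ (inside ∷ S) e =
  fz , cong (inside ∷_) (Empty-unique λ (_ , x∈S) → contradiction (subst (1 ≤_) (suc-injective e) (∈⇒1≤∣∣ x∈S)) λ ())
∣p∣≡1⇒p≡⁅x⁆ (outside ∷ S) e with ∣p∣≡1⇒p≡⁅x⁆ S e
... | w , refl = fs w , refl

all-in⇒∣p∣≡n : ∀ {n} {S : Subset n} → (∀ x → x ∈ S) → ∣ S ∣ ≡ n
all-in⇒∣p∣≡n {n} {S} all = ≤-antisym (∣p∣≤n S) (subst (_≤ ∣ S ∣) (∣⊤∣≡n n) (p⊆q⇒∣p∣≤∣q∣ {p = ⊤} λ {x} _ → all x))

∣∁⁅x⁆∣≡n∸1 : ∀ {n} (x : Fin n) → ∣ ∁ ⁅ x ⁆ ∣ ≡ n ∸ 1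
∣∁⁅x⁆∣≡n∸1 {n} x = trans (∣∁p∣≡n∸∣p∣ ⁅ x ⁆) (cong (n ∸_) (∣⁅x⁆∣≡1 x))

module _ {n} (G : Graph n) {k a : ℕ} where

  γ≥1 : 1 ≤ n → IsGammaR G k a → 1 ≤ a
  γ≥1 1≤n ((S , _ , dominating , refl) , _) with fromℕ< 1≤n ∈? S
  ... | yes v∈S = ∈⇒1≤∣∣ v∈S
  ... | no v∉S  = let _ , w∈S , _ = dominating (fromℕ< 1≤n) v∉S in ∈⇒1≤∣∣ w∈S

  γ≤n : IsGammaR G k a → a ≤ n
  γ≤n (_ , minimal) = subst (a ≤_) (∣⊤∣≡n n) (minimal ⊤ (λ u _ u∉⊤ → contradiction ∈⊤ u∉⊤) (λ v v∉⊤ → contradiction ∈⊤ v∉⊤))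

  γ≤n∸1-of-edge : 1 ≤ k → HasEdge G → IsGammaR G k a → a ≤ n ∸ 1
  γ≤n∸1-of-edge 1≤k (u , v , u~v) (_ , minimal) = subst (a ≤_) (∣∁⁅x⁆∣≡n∸1 u) (minimal (∁ ⁅ u ⁆) resolving dominating)
    where
    outside⇒≡u : ∀ {x} → x ∉ ∁ ⁅ u ⁆ → x ≡ u
    outside⇒≡u x∉ = x∈⁅y⁆⇒x≡y u (x∉∁p⇒x∈p x∉)
    resolving : Resolving G (∁ ⁅ u ⁆)
    resolving x y x∉ y∉ _ = trans (outside⇒≡u x∉) (sym (outside⇒≡u y∉))
    dominating : KDominating G k (∁ ⁅ u ⁆)
    dominating x x∉ with outside⇒≡u x∉
    ... | refl = v , x∉p⇒x∈∁p (edge⇒≢ G u~v ∘ sym ∘ x∈⁅y⁆⇒x≡y u) , 1 , 1≤k , step (trans (adj-sym G v x) u~v) here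

  γ≡n-of-edgeless : Edgeless G → IsGammaR G k a → a ≡ n
  γ≡n-of-edgeless edgeless ((S , _ , dominating , refl) , _) = all-in⇒∣p∣≡n every-vertex-in
    where
    walk⇒≡ : ∀ {u v j} → Walk G u v j → u ≡ v
    walk⇒≡ here = refl
    walk⇒≡ {u} (step {v = v} u~v _) = contradiction (trans (sym u~v) (edgeless u v)) λ ()
    every-vertex-in : ∀ x → x ∈ S
    every-vertex-in x with x ∈? S
    ... | yes x∈S = x∈S
    ... | no x∉S  = let w , w∈S , _ , _ , w⇝x = dominating x x∉S in subst (_∈ S) (walk⇒≡ w⇝x) w∈S

  -- In a complete graph all vertices outside S are at distance 1 from every vertex of S,
  -- so a resolving set S misses at most one vertex.
  γ≥n∸1-of-complete : Complete G → IsGammaR G k a → n ∸ 1 ≤ a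
  γ≥n∸1-of-complete complete ((S , resolving , _ , refl) , _) with any? (λ x → x ∈? ∁ S)
  ... | no none = subst (n ∸ 1 ≤_) (sym (all-in⇒∣p∣≡n (λ x → x∉∁p⇒x∈p λ x∈∁S → none (x , x∈∁S)))) (m∸n≤m n 1)
  ... | yes (u , u∈∁S) = subst (_≤ ∣ S ∣) (∣∁⁅x⁆∣≡n∸1 u) (p⊆q⇒∣p∣≤∣q∣ ∁⁅u⁆⊆S)
    where
    unit-distance : ∀ {x w} → x ∉ S → w ∈ S → IsDist G x w 1
    unit-distance x∉S w∈S = edge⇒IsDist1 (complete _ _ λ { refl → x∉S w∈S })
    ∁⁅u⁆⊆S : ∀ {x} → x ∈ ∁ ⁅ u ⁆ → x ∈ S
    ∁⁅u⁆⊆S {x} x∈ with x ∈? S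
    ... | yes x∈S = x∈S
    ... | no x∉S  = contradiction (x∈⁅x⁆ u) (subst (_∉ ⁅ u ⁆) x≡u (x∈∁p⇒x∉p x∈))
      where
      u∉S = x∈∁p⇒x∉p u∈∁S
      x≡u : x ≡ u
      x≡u = resolving x u x∉S u∉S λ w w∈S → same-distance (unit-distance x∉S w∈S) (unit-distance u∉S w∈S)

  γ≡1⇔short-path : 1 ≤ n → IsGammaR G k a → a ≡ 1 ⇔ (G ≅ P n × n ≤ suc k)
  γ≡1⇔short-path 1≤n γ@((S , resolving , dominating , ∣S∣≡a) , minimal) = mk⇔ ⇒ ⇐
    where
    ⇒ : a ≡ 1 → G ≅ P n × n ≤ suc k
    ⇒ refl with ∣p∣≡1⇒p≡⁅x⁆ S ∣S∣≡a
    ... | w , refl = labelling⇒≅P L , PathLabellingProperties.order-≤ L (SingletonBasis.dist≤k resolving dominating)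
      where L = SingletonBasis.labelling resolving dominating
    ⇐ : G ≅ P n × n ≤ suc k → a ≡ 1
    ⇐ (G≅Pn , n≤1+k) = ≤-antisym (subst (a ≤_) (∣⁅x⁆∣≡1 r) (minimal ⁅ r ⁆ root-resolving (root-dominating bound))) (γ≥1 1≤n γ)
      where
      L = proj₁ (≅P⇒labelling {G = G} G≅Pn)
      open PathLabelling L
      open PathLabellingProperties L
      r = proj₁ (label-surjective 1≤n)
      open Root (proj₂ (label-surjective 1≤n))
      bound : ∀ v → label v ≤ k
      bound v = ≤-pred (≤-trans (proj₂ (≅P⇒labelling {G = G} G≅Pn) v) n≤1+k)

module PathAndComplementPath {n} {G : Graph n} (L : PathLabelling G) (Lc : PathLabelling (complement G)) where
  open PathLabelling L
  open PathLabellingProperties L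
  private module C = PathLabellingProperties Lc

  -- A vertex whose label is near every label would be isolated in the complement.
  no-label-near-all : 2 ≤ n → ∀ {ℓ} → ℓ < n → ¬ (∀ {y} → y < n → Near ℓ y)
  no-label-near-all 2≤n ℓ<n near-all with label-surjective ℓ<n
  ... | x , refl = let u , x~u = C.has-neighbour 2≤n x in to complement-edge⇔not-near x~u (near-all (label<n u))

  -- The end r of the complementary path has a single neighbour there, while in G
  -- it is adjacent to at most the two vertices whose labels are next to its own.
  module _ (5≤n : 5 ≤ n) where
    private
      r : Fin n
      r = proj₁ (C.label-surjective (≤-trans (s≤s z≤n) 5≤n))
      open C.Root (proj₂ (C.label-surjective (≤-trans (s≤s z≤n) 5≤n)))
      below5 : ∀ p {_ : T (p <ᵇ 5)} → p < n
      below5 p {p<ᵇ5} = ≤-trans (<ᵇ⇒< p 5 p<ᵇ5) 5≤n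
      collide : ∀ {d p q} → label r ≡ d → p < n → q < n → ¬ Near d p → ¬ Near d q → p ≡ q
      collide {d} lr p<n q<n far-p far-q with label-surjective p<n | label-surjective q<n
      ... | x , lx | y , ly = trans (sym lx) (trans (cong label (root-neighbour-unique (r~ lx far-p) (r~ ly far-q))) ly)
        where
        r~ : ∀ {x p} → label x ≡ p → ¬ Near d p → adj (complement G) r x ≡ true
        r~ lx far = from complement-edge⇔not-near (subst₂ (λ a b → ¬ Near a b) (sym lr) (sym lx) far)

    order≥5-impossible : ⊥
    order≥5-impossible with label r in lr
    ... | 0                 = contradiction (collide lr (below5 3) (below5 4) [ (λ ()) , (λ ()) ] [ (λ ()) , (λ ()) ]) λ ()
    ... | 1                 = contradiction (collide lr (below5 3) (below5 4) [ (λ ()) , (λ ()) ] [ (λ ()) , (λ ()) ]) λ ()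
    ... | 2                 = contradiction (collide lr (below5 0) (below5 4) [ (λ ()) , (λ ()) ] [ (λ ()) , (λ ()) ]) λ ()
    ... | suc (suc (suc _)) = contradiction (collide lr (below5 0) (below5 1) [ (λ ()) , (λ ()) ] [ (λ ()) , (λ ()) ]) λ ()

path-labellings⇒order≡4 : ∀ {n} {G : Graph n} → PathLabelling G → PathLabelling (complement G) → 2 ≤ n → n ≡ 4
path-labellings⇒order≡4 {0} _ _ ()
path-labellings⇒order≡4 {1} _ _ (s≤s ())
path-labellings⇒order≡4 {2} L Lc 2≤n = ⊥-elim (PathAndComplementPath.no-label-near-all L Lc 2≤n (s≤s z≤n) near-0)
  where
  near-0 : ∀ {y} → y < 2 → Near 0 y
  near-0 {0}           _ = inj₁ refl
  near-0 {1}           _ = inj₂ up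
  near-0 {suc (suc _)} (s≤s (s≤s ()))
path-labellings⇒order≡4 {3} L Lc 2≤n = ⊥-elim (PathAndComplementPath.no-label-near-all L Lc 2≤n (s≤s (s≤s z≤n)) near-1)
  where
  near-1 : ∀ {y} → y < 3 → Near 1 y
  near-1 {0}                 _ = inj₂ down
  near-1 {1}                 _ = inj₁ refl
  near-1 {2}                 _ = inj₂ up
  near-1 {suc (suc (suc _))} (s≤s (s≤s (s≤s ())))
path-labellings⇒order≡4 {4} _ _ _ = refl
path-labellings⇒order≡4 {suc (suc (suc (suc (suc m))))} L Lc _ =
  ⊥-elim (PathAndComplementPath.order≥5-impossible L Lc (m≤m+n 5 m))

path-and-complement-path⇒order≡4 : ∀ {n} {G : Graph n} → 2 ≤ n → G ≅ P n → complement G ≅ P n → n ≡ 4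
path-and-complement-path⇒order≡4 {G = G} 2≤n f g =
  path-labellings⇒order≡4 (proj₁ (≅P⇒labelling {G = G} f)) (proj₁ (≅P⇒labelling {G = complement G} g)) 2≤n

P2≡K2 : ∀ u v → adj (P 2) u v ≡ adj (K 2) u v
P2≡K2 fz      fz      = refl
P2≡K2 fz      (fs fz) = refl
P2≡K2 (fs fz) fz      = refl
P2≡K2 (fs fz) (fs fz) = refl

complement-P2≡Kbar2 : ∀ u v → adj (complement (P 2)) u v ≡ adj (Kbar 2) u v
complement-P2≡Kbar2 fz      fz      = refl
complement-P2≡Kbar2 fz      (fs fz) = refl
complement-P2≡Kbar2 (fs fz) fz      = refl
complement-P2≡Kbar2 (fs fz) (fs fz) = refl

complement-Kbar2≡P2 : ∀ u v → adj (complement (Kbar 2)) u v ≡ adj (P 2) u v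
complement-Kbar2≡P2 fz      fz      = refl
complement-Kbar2≡P2 fz      (fs fz) = refl
complement-Kbar2≡P2 (fs fz) fz      = refl
complement-Kbar2≡P2 (fs fz) (fs fz) = refl

complement-P4≅P4 : complement (P 4) ≅ P 4
complement-P4≅P4 = mk↔ₛ′ σ σ⁻¹ σσ⁻¹ σ⁻¹σ , adj-preserved
  where
  σ σ⁻¹ : Fin 4 → Fin 4
  σ fz                = fs fz
  σ (fs fz)           = fs (fs (fs fz))
  σ (fs (fs fz))      = fz
  σ (fs (fs (fs fz))) = fs (fs fz)
  σ⁻¹ fz                = fs (fs fz)
  σ⁻¹ (fs fz)           = fz
  σ⁻¹ (fs (fs fz))      = fs (fs (fs fz))
  σ⁻¹ (fs (fs (fs fz))) = fs fz
  σσ⁻¹ : ∀ i → σ (σ⁻¹ i) ≡ i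
  σσ⁻¹ fz                = refl
  σσ⁻¹ (fs fz)           = refl
  σσ⁻¹ (fs (fs fz))      = refl
  σσ⁻¹ (fs (fs (fs fz))) = refl
  σ⁻¹σ : ∀ i → σ⁻¹ (σ i) ≡ i
  σ⁻¹σ fz                = refl
  σ⁻¹σ (fs fz)           = refl
  σ⁻¹σ (fs (fs fz))      = refl
  σ⁻¹σ (fs (fs (fs fz))) = refl
  adj-preserved : ∀ u v → adj (complement (P 4)) u v ≡ adj (P 4) (σ u) (σ v)
  adj-preserved fz                fz                = refl
  adj-preserved fz                (fs fz)           = refl
  adj-preserved fz                (fs (fs fz))      = refl
  adj-preserved fz                (fs (fs (fs fz))) = refl
  adj-preserved (fs fz)           fz                = refl
  adj-preserved (fs fz)           (fs fz)           = refl
  adj-preserved (fs fz)           (fs (fs fz))      = refl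
  adj-preserved (fs fz)           (fs (fs (fs fz))) = refl
  adj-preserved (fs (fs fz))      fz                = refl
  adj-preserved (fs (fs fz))      (fs fz)           = refl
  adj-preserved (fs (fs fz))      (fs (fs fz))      = refl
  adj-preserved (fs (fs fz))      (fs (fs (fs fz))) = refl
  adj-preserved (fs (fs (fs fz))) fz                = refl
  adj-preserved (fs (fs (fs fz))) (fs fz)           = refl
  adj-preserved (fs (fs (fs fz))) (fs (fs fz))      = refl
  adj-preserved (fs (fs (fs fz))) (fs (fs (fs fz))) = refl

small-paths-and-complements : ∀ {n} {G : Graph n} → 2 ≤ n →
  (G ≅ K 2 ⊎ G ≅ Kbar 2 ⊎ G ≅ P 3 ⊎ G ≅ complement (P 3)) ⇔ (n ≤ 3 × (G ≅ P n ⊎ complement G ≅ P n))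
small-paths-and-complements {n} {G} 2≤n = mk⇔ ⇒ ⇐
  where
  order≤3 : ∀ {m} {H : Graph m} → G ≅ H → m ≤ 3 → n ≤ 3
  order≤3 {H = H} f = subst (_≤ 3) (sym (≅-order {G = G} {H = H} f))
  ⇒ : G ≅ K 2 ⊎ G ≅ Kbar 2 ⊎ G ≅ P 3 ⊎ G ≅ complement (P 3) → n ≤ 3 × (G ≅ P n ⊎ complement G ≅ P n)
  ⇒ (inj₁ f) = order≤3 {H = K 2} f (s≤s (s≤s z≤n)) ,
    inj₁ (≅P-resize {G = G} (≅-trans {G = G} {H = K 2} f {I = P 2} (same-adj⇒≅ {G = K 2} {H = P 2} λ u v → sym (P2≡K2 u v))))
  ⇒ (inj₂ (inj₁ f)) = order≤3 {H = Kbar 2} f (s≤s (s≤s z≤n)) ,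
    inj₂ (≅P-resize {G = complement G} (≅-trans {G = complement G} {H = complement (Kbar 2)} (≅-complement {G = G} {H = Kbar 2} f)
      {I = P 2} (same-adj⇒≅ {G = complement (Kbar 2)} {H = P 2} complement-Kbar2≡P2)))
  ⇒ (inj₂ (inj₂ (inj₁ f))) = order≤3 {H = P 3} f ≤-refl , inj₁ (≅P-resize {G = G} f)
  ⇒ (inj₂ (inj₂ (inj₂ f))) = order≤3 {H = complement (P 3)} f ≤-refl ,
    inj₂ (≅P-resize {G = complement G} (≅-trans {G = complement G} {H = complement (complement (P 3))} (≅-complement {G = G} {H = complement (P 3)} f)
      {I = P 3} (same-adj⇒≅ {G = complement (complement (P 3))} {H = P 3} (complement-involutive (P 3)))))
  ⇐ : n ≤ 3 × (G ≅ P n ⊎ complement G ≅ P n) → G ≅ K 2 ⊎ G ≅ Kbar 2 ⊎ G ≅ P 3 ⊎ G ≅ complement (P 3)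
  ⇐ (n≤3 , path) = cases 2≤n n≤3 path
    where
    cases : ∀ {m} {H : Graph m} → 2 ≤ m → m ≤ 3 → H ≅ P m ⊎ complement H ≅ P m →
            H ≅ K 2 ⊎ H ≅ Kbar 2 ⊎ H ≅ P 3 ⊎ H ≅ complement (P 3)
    cases {0} () _ _
    cases {1} (s≤s ()) _ _
    cases {2} {H} _ _ (inj₁ f) = inj₁ (≅-trans {G = H} {H = P 2} f {I = K 2} (same-adj⇒≅ {G = P 2} {H = K 2} P2≡K2))
    cases {2} {H} _ _ (inj₂ f) =
      inj₂ (inj₁ (≅-trans {G = H} {H = complement (P 2)} (complement-≅ {G = H} {H = P 2} f)
                  {I = Kbar 2} (same-adj⇒≅ {G = complement (P 2)} {H = Kbar 2} complement-P2≡Kbar2)))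
    cases {3}             _ _ (inj₁ f) = inj₂ (inj₂ (inj₁ f))
    cases {3} {H}         _ _ (inj₂ f) = inj₂ (inj₂ (inj₂ (complement-≅ {G = H} {H = P 3} f)))
    cases {suc (suc (suc (suc _)))} _ (s≤s (s≤s (s≤s ()))) _

n+[n∸1]≡2n∸1 : ∀ n → 1 ≤ n → n + (n ∸ 1) ≡ 2 * n ∸ 1
n+[n∸1]≡2n∸1 (suc m) _ rewrite +-identityʳ m | +-suc m m = refl

below-extremal : ∀ {n a b} → 2 ≤ n → a ≤ n ∸ 1 → b ≤ n ∸ 1 → a + b < 2 * n ∸ 1 × a * b < n * (n ∸ 1)
below-extremal {suc (suc m)} {a} {b} _ a≤ b≤ =
  subst (a + b <_) (n+[n∸1]≡2n∸1 (2 + m) (s≤s z≤n)) (+-mono-<-≤ (s≤s a≤) b≤) ,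
  ≤-<-trans (*-mono-≤ a≤ b≤) (*-monoˡ-< (suc m) (n<1+n (suc m)))
below-extremal {1} (s≤s ())

both-one⇔sum≡2 : ∀ {a b} → 1 ≤ a → 1 ≤ b → (a ≡ 1 × b ≡ 1) ⇔ (a + b ≡ 2)
both-one⇔sum≡2 {a} {b} 1≤a 1≤b = mk⇔ (λ { (refl , refl) → refl }) ⇐
  where
  ⇐ : a + b ≡ 2 → a ≡ 1 × b ≡ 1
  ⇐ e = ≤-antisym (≤-pred (subst (_≤ 2) (+-comm a 1) (subst (a + 1 ≤_) e (+-monoʳ-≤ a 1≤b)))) 1≤a ,
        ≤-antisym (≤-pred (subst (1 + b ≤_) e (+-monoˡ-≤ b 1≤a))) 1≤b

both-one⇔product≡1 : ∀ {a b} → (a ≡ 1 × b ≡ 1) ⇔ (a * b ≡ 1)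
both-one⇔product≡1 {a} {b} = mk⇔ (λ { (refl , refl) → refl }) λ e → m*n≡1⇒m≡1 a b e , m*n≡1⇒n≡1 a b e

not-both-one⇒lower-bounds : ∀ {a b} → 1 ≤ a → 1 ≤ b → ¬ (a ≡ 1 × b ≡ 1) → 3 ≤ a + b × 2 ≤ a * b
not-both-one⇒lower-bounds {1}     {1}           _   _   not-both = contradiction (refl , refl) not-both
not-both-one⇒lower-bounds {1}     {suc (suc _)} _   _   _        = s≤s (s≤s (s≤s z≤n)) , s≤s (s≤s z≤n)
not-both-one⇒lower-bounds {suc (suc a)} {b}     _   1≤b _        =
  +-mono-≤ {2} {suc (suc a)} (s≤s (s≤s z≤n)) 1≤b , *-mono-≤ {2} {suc (suc a)} (s≤s (s≤s z≤n)) 1≤b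

one-of-sum≡3 : ∀ {a b} → 1 ≤ a → 1 ≤ b → a + b ≡ 3 → a ≡ 1 ⊎ b ≡ 1
one-of-sum≡3 {a} {b} 1≤a 1≤b e with m≤n⇒m<n∨m≡n 1≤a
... | inj₂ 1≡a = inj₁ (sym 1≡a)
... | inj₁ 2≤a = inj₂ (≤-antisym (≤-pred (≤-pred (subst (2 + b ≤_) e (+-monoˡ-≤ b 2≤a)))) 1≤b)

one-of-product≡2 : ∀ {a b} → 1 ≤ a → 1 ≤ b → a * b ≡ 2 → a ≡ 1 ⊎ b ≡ 1
one-of-product≡2 {a} {b} 1≤a 1≤b e with m≤n⇒m<n∨m≡n 1≤a
... | inj₂ 1≡a = inj₁ (sym 1≡a)
... | inj₁ 2≤a = inj₂ (≤-antisym (*-cancelˡ-≤ 2 (subst (2 * b ≤_) e (*-monoˡ-≤ b 2≤a))) 1≤b)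

has-edge? : ∀ {n} (G : Graph n) → Dec (HasEdge G)
has-edge? G = any? λ u → any? λ v → adj G u v ≟ᵇ true

complete⇒has-edge : ∀ {n} {G : Graph n} → 2 ≤ n → Complete G → HasEdge G
complete⇒has-edge {1} (s≤s ()) _
complete⇒has-edge {suc (suc _)} _ complete = fz , fs fz , complete fz (fs fz) λ ()

edgeless⊎complete⊎both-have-edges : ∀ {n} (G : Graph n) → Edgeless G ⊎ Complete G ⊎ (HasEdge G × HasEdge (complement G))
edgeless⊎complete⊎both-have-edges G with has-edge? G | has-edge? (complement G)
... | no none    | _          = inj₁ λ u v → ¬-not λ e → none (u , v , e)
... | yes _      | no noneᶜ   = inj₂ (inj₁ λ u v u≢v → ¬-not λ e → noneᶜ (u , v , non-edge⇒complement-edge G u≢v e))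
... | yes edge   | yes edgeᶜ = inj₂ (inj₂ (edge , edgeᶜ))

γ≡n∸1-of-complete : ∀ {n} (G : Graph n) {k a} → 2 ≤ n → 1 ≤ k → Complete G → IsGammaR G k a → a ≡ n ∸ 1
γ≡n∸1-of-complete G 2≤n 1≤k complete γ =
  ≤-antisym (γ≤n∸1-of-edge G 1≤k (complete⇒has-edge {G = G} 2≤n complete) γ) (γ≥n∸1-of-complete G complete γ)

ExtremalBounds : ℕ → ℕ → ℕ → Set → Set
ExtremalBounds n a b R =
  (a + b ≤ 2 * n ∸ 1 × a * b ≤ n * (n ∸ 1)) × ((a + b ≡ 2 * n ∸ 1) ⇔ R) × ((a * b ≡ n * (n ∸ 1)) ⇔ R)

extremal-bounds : ∀ {n a b R} → a + b ≡ 2 * n ∸ 1 → a * b ≡ n * (n ∸ 1) → R → ExtremalBounds n a b R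
extremal-bounds sum product r = (≤-reflexive sum , ≤-reflexive product) , mk⇔ (λ _ → r) (λ _ → sum) , mk⇔ (λ _ → r) (λ _ → product)

extremal-values-bounds : ∀ {n a b R} → 1 ≤ n → (a ≡ n × b ≡ n ∸ 1) ⊎ (a ≡ n ∸ 1 × b ≡ n) → R → ExtremalBounds n a b R
extremal-values-bounds {n} 1≤n (inj₁ (refl , refl)) = extremal-bounds {n} {n} {n ∸ 1} (n+[n∸1]≡2n∸1 n 1≤n) refl
extremal-values-bounds {n} 1≤n (inj₂ (refl , refl)) = extremal-bounds {n} {n ∸ 1} {n} (trans (+-comm (n ∸ 1) n) (n+[n∸1]≡2n∸1 n 1≤n)) (*-comm (n ∸ 1) n)

non-extremal-bounds : ∀ {n a b R} → 2 ≤ n → a ≤ n ∸ 1 → b ≤ n ∸ 1 → ¬ R → ExtremalBounds n a b R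
non-extremal-bounds 2≤n a≤ b≤ ¬r with below-extremal 2≤n a≤ b≤
... | sum< , product< = (<⇒≤ sum< , <⇒≤ product<) , mk⇔ (⊥-elim ∘ <⇒≢ sum<) (⊥-elim ∘ ¬r) , mk⇔ (⊥-elim ∘ <⇒≢ product<) (⊥-elim ∘ ¬r)

upper-bounds : ∀ {n} {G : Graph n} {k a b} → 2 ≤ n → 1 ≤ k → IsGammaR G k a → IsGammaR (complement G) k b →
  ExtremalBounds n a b (G ≅ K n ⊎ G ≅ Kbar n)
upper-bounds {n} {G} 2≤n 1≤k γ γᶜ with edgeless⊎complete⊎both-have-edges G
... | inj₁ edgeless = extremal-values-bounds {n} 1≤n
  (inj₁ (γ≡n-of-edgeless G edgeless γ , γ≡n∸1-of-complete (complement G) 2≤n 1≤k (edgeless⇒complement-complete edgeless) γᶜ))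
  (inj₂ (edgeless⇒≅Kbar {G = G} edgeless))
  where 1≤n = ≤-trans (s≤s z≤n) 2≤n
... | inj₂ (inj₁ complete) = extremal-values-bounds {n} 1≤n
  (inj₂ (γ≡n∸1-of-complete G 2≤n 1≤k complete γ , γ≡n-of-edgeless (complement G) (complete⇒complement-edgeless complete) γᶜ))
  (inj₁ (complete⇒≅K {G = G} complete))
  where 1≤n = ≤-trans (s≤s z≤n) 2≤n
... | inj₂ (inj₂ (edge , edgeᶜ)) =
  non-extremal-bounds {n} 2≤n (γ≤n∸1-of-edge G 1≤k edge γ) (γ≤n∸1-of-edge (complement G) 1≤k edgeᶜ γᶜ) [ not-complete , not-edgeless ]
  where
  not-complete : ¬ G ≅ K n
  not-complete f = let u , v , e = edgeᶜ in
    contradiction (trans (sym e) (complete⇒complement-edgeless (≅-complete {G = G} {H = K n} f (K-complete n)) u v)) λ ()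
  not-edgeless : ¬ G ≅ Kbar n
  not-edgeless f = let u , v , e = edge in
    contradiction (trans (sym e) (≅-edgeless {G = G} {H = Kbar n} f (λ _ _ → refl) u v)) λ ()

LowerBounds : ℕ → ℕ → ℕ → ℕ → Set → Set
LowerBounds a b s p R = (s ≤ a + b × p ≤ a * b) × ((a + b ≡ s) ⇔ R) × ((a * b ≡ p) ⇔ R)

both-one⇔P4 : ∀ {n} {G : Graph n} {k a b} → 2 ≤ n → 3 ≤ k → IsGammaR G k a → IsGammaR (complement G) k b →
  (a ≡ 1 × b ≡ 1) ⇔ G ≅ P 4
both-one⇔P4 {n} {G} {k} {a} {b} 2≤n 3≤k γ γᶜ = mk⇔ ⇒ ⇐
  where
  1≤n = ≤-trans (s≤s z≤n) 2≤n
  short = γ≡1⇔short-path G 1≤n γ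
  shortᶜ = γ≡1⇔short-path (complement G) 1≤n γᶜ
  ⇒ : a ≡ 1 × b ≡ 1 → G ≅ P 4
  ⇒ (a≡1 , b≡1) with to short a≡1 | to shortᶜ b≡1
  ... | path , _ | pathᶜ , _ = subst (λ m → G ≅ P m) (path-and-complement-path⇒order≡4 {G = G} 2≤n path pathᶜ) path
  ⇐ : G ≅ P 4 → a ≡ 1 × b ≡ 1
  ⇐ f = from short (≅P-resize {G = G} f , n≤1+k) , from shortᶜ (≅P-resize {G = complement G} fᶜ , n≤1+k)
    where
    n≤1+k : n ≤ suc k
    n≤1+k = subst (_≤ suc k) (sym (≅-order {G = G} {H = P 4} f)) (s≤s 3≤k)
    fᶜ : complement G ≅ P 4
    fᶜ = ≅-trans {G = complement G} {H = complement (P 4)} (≅-complement {G = G} {H = P 4} f) {I = P 4} complement-P4≅P4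

lower-bounds-k≥3 : ∀ {n} {G : Graph n} {k a b} → 2 ≤ n → 3 ≤ k → IsGammaR G k a → IsGammaR (complement G) k b →
  LowerBounds a b 2 1 (G ≅ P 4)
lower-bounds-k≥3 {G = G} 2≤n 3≤k γ γᶜ =
  (+-mono-≤ 1≤a 1≤b , *-mono-≤ 1≤a 1≤b) ,
  both-one⇔P4 {G = G} 2≤n 3≤k γ γᶜ ⇔-∘ ⇔-sym (both-one⇔sum≡2 1≤a 1≤b) ,
  both-one⇔P4 {G = G} 2≤n 3≤k γ γᶜ ⇔-∘ ⇔-sym both-one⇔product≡1
  where
  1≤a = γ≥1 G (≤-trans (s≤s z≤n) 2≤n) γ
  1≤b = γ≥1 (complement G) (≤-trans (s≤s z≤n) 2≤n) γᶜ

γ≤2-of-order≤3 : ∀ {n} (G : Graph n) {k a} → 1 ≤ k → n ≤ 3 → (3 ≤ n → HasEdge G) → IsGammaR G k a → a ≤ 2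
γ≤2-of-order≤3 G 1≤k n≤3 edge γ with m≤n⇒m<n∨m≡n n≤3
... | inj₁ (s≤s n≤2) = ≤-trans (γ≤n G γ) n≤2
... | inj₂ refl      = γ≤n∸1-of-edge G 1≤k (edge ≤-refl) γ

path⇒complement-has-edge : ∀ {n} {G : Graph n} → 3 ≤ n → G ≅ P n → HasEdge (complement G)
path⇒complement-has-edge {G = G} 3≤n f
  with PathLabellingProperties.path-has-non-edge (proj₁ (≅P⇒labelling {G = G} f)) 3≤n
... | u , v , u≢v , non-edge = u , v , non-edge⇒complement-edge G u≢v non-edge

complement-path⇒has-edge : ∀ {n} {G : Graph n} → 3 ≤ n → complement G ≅ P n → HasEdge G
complement-path⇒has-edge {G = G} 3≤n f with path⇒complement-has-edge {G = complement G} 3≤n f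
... | u , v , e = u , v , trans (sym (complement-involutive G u v)) e

lower-bounds-k≡2 : ∀ {n} {G : Graph n} {a b} → 2 ≤ n → IsGammaR G 2 a → IsGammaR (complement G) 2 b →
  LowerBounds a b 3 2 (G ≅ K 2 ⊎ G ≅ Kbar 2 ⊎ G ≅ P 3 ⊎ G ≅ complement (P 3))
lower-bounds-k≡2 {n} {G} {a} {b} 2≤n γ γᶜ =
  not-both-one⇒lower-bounds 1≤a 1≤b not-both-one ,
  mk⇔ (⇒ ∘ one-of-sum≡3 1≤a 1≤b) (sum ∘ one-and-two ∘ ⇐) ,
  mk⇔ (⇒ ∘ one-of-product≡2 1≤a 1≤b) (product ∘ one-and-two ∘ ⇐)
  where
  1≤n = ≤-trans (s≤s z≤n) 2≤n
  1≤a = γ≥1 G 1≤n γ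
  1≤b = γ≥1 (complement G) 1≤n γᶜ
  short = γ≡1⇔short-path G 1≤n γ
  shortᶜ = γ≡1⇔short-path (complement G) 1≤n γᶜ
  small = small-paths-and-complements {G = G} 2≤n

  not-both-one : ¬ (a ≡ 1 × b ≡ 1)
  not-both-one (a≡1 , b≡1) with to short a≡1 | to shortᶜ b≡1
  ... | path , n≤3 | pathᶜ , _ = contradiction (subst (_≤ 3) (path-and-complement-path⇒order≡4 {G = G} 2≤n path pathᶜ) n≤3) λ { (s≤s (s≤s (s≤s ()))) }

  ⇒ : a ≡ 1 ⊎ b ≡ 1 → G ≅ K 2 ⊎ G ≅ Kbar 2 ⊎ G ≅ P 3 ⊎ G ≅ complement (P 3)
  ⇒ (inj₁ a≡1) = let path , n≤3 = to short a≡1 in from small (n≤3 , inj₁ path)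
  ⇒ (inj₂ b≡1) = let pathᶜ , n≤3 = to shortᶜ b≡1 in from small (n≤3 , inj₂ pathᶜ)

  ⇐ : G ≅ K 2 ⊎ G ≅ Kbar 2 ⊎ G ≅ P 3 ⊎ G ≅ complement (P 3) → a ≡ 1 ⊎ b ≡ 1
  ⇐ l with to small l
  ... | n≤3 , inj₁ path  = inj₁ (from short (path , n≤3))
  ... | n≤3 , inj₂ pathᶜ = inj₂ (from shortᶜ (pathᶜ , n≤3))

  two : ∀ {c} → 1 ≤ c → c ≤ 2 → c ≢ 1 → c ≡ 2
  two 1≤c c≤2 c≢1 = ≤-antisym c≤2 (≤∧≢⇒< 1≤c (c≢1 ∘ sym))

  one-and-two : a ≡ 1 ⊎ b ≡ 1 → (a ≡ 1 × b ≡ 2) ⊎ (a ≡ 2 × b ≡ 1)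
  one-and-two (inj₁ a≡1) with to short a≡1
  ... | path , n≤3 = inj₁ (a≡1 , two 1≤b b≤2 λ b≡1 → not-both-one (a≡1 , b≡1))
    where
    b≤2 = γ≤2-of-order≤3 (complement G) (s≤s z≤n) n≤3 (λ 3≤n → path⇒complement-has-edge {G = G} 3≤n path) γᶜ
  one-and-two (inj₂ b≡1) with to shortᶜ b≡1
  ... | pathᶜ , n≤3 = inj₂ (two 1≤a a≤2 (λ a≡1 → not-both-one (a≡1 , b≡1)) , b≡1)
    where
    a≤2 = γ≤2-of-order≤3 G (s≤s z≤n) n≤3 (λ 3≤n → complement-path⇒has-edge {G = G} 3≤n pathᶜ) γ

  sum : (a ≡ 1 × b ≡ 2) ⊎ (a ≡ 2 × b ≡ 1) → a + b ≡ 3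
  sum (inj₁ (refl , refl)) = refl
  sum (inj₂ (refl , refl)) = refl

  product : (a ≡ 1 × b ≡ 2) ⊎ (a ≡ 2 × b ≡ 1) → a * b ≡ 2
  product (inj₁ (refl , refl)) = refl
  product (inj₂ (refl , refl)) = refl

theorem6p1 : ∀ {n} → 2 ≤ n → (G : Graph n) → (k a b : ℕ) →
    IsGammaR G k a → IsGammaR (complement G) k b →
    (k ≡ 2 →
      (3 ≤ a + b × a + b ≤ 2 * n ∸ 1 × 2 ≤ a * b × a * b ≤ n * (n ∸ 1))
      × ((a + b ≡ 3) ⇔ (G ≅ K 2 ⊎ G ≅ Kbar 2 ⊎ G ≅ P 3 ⊎ G ≅ complement (P 3)))
      × ((a * b ≡ 2) ⇔ (G ≅ K 2 ⊎ G ≅ Kbar 2 ⊎ G ≅ P 3 ⊎ G ≅ complement (P 3)))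
      × ((a + b ≡ 2 * n ∸ 1) ⇔ (G ≅ K n ⊎ G ≅ Kbar n))
      × ((a * b ≡ n * (n ∸ 1)) ⇔ (G ≅ K n ⊎ G ≅ Kbar n)))
    × (3 ≤ k →
      (2 ≤ a + b × a + b ≤ 2 * n ∸ 1 × 1 ≤ a * b × a * b ≤ n * (n ∸ 1))
      × ((a + b ≡ 2) ⇔ G ≅ P 4)
      × ((a * b ≡ 1) ⇔ G ≅ P 4)
      × ((a + b ≡ 2 * n ∸ 1) ⇔ (G ≅ K n ⊎ G ≅ Kbar n))
      × ((a * b ≡ n * (n ∸ 1)) ⇔ (G ≅ K n ⊎ G ≅ Kbar n)))
theorem6p1 2≤n G k a b γ γᶜ =
  (λ { refl → combine (lower-bounds-k≡2 {G = G} 2≤n γ γᶜ) (upper-bounds 2≤n (s≤s z≤n) γ γᶜ) }) ,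
  λ 3≤k → combine (lower-bounds-k≥3 {G = G} 2≤n 3≤k γ γᶜ) (upper-bounds 2≤n (≤-trans (s≤s z≤n) 3≤k) γ γᶜ)
  where
  combine : ∀ {A B C D S T U V : Set} → (A × B) × S × T → (C × D) × U × V → (A × C × B × D) × S × T × U × V
  combine ((l₁ , l₂) , s , t) ((u₁ , u₂) , u , v) = (l₁ , u₁ , l₂ , u₂) , s , t , u , v
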